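{- Let $\mathbf a=(a_1,\dots,a_n)$ be an area sequence with $a_n=0$, and let $v_1,\dots,v_n$ be integers with $0\le v_i\le a_i$. Then there is a unique acyclic orientation of $\Gamma_{\mathbf a}$ in which, for each $i$, exactly $v_i$ of the edges $\{i,i+1\},\dots,\{i,i+a_i\}$ are ascending.
   Context: $\mathbf a$ is an integer sequence with $0\le a_i\le n-1$, $a_i-1\le a_{i+1}$ (indices mod $n$) and $a_n=0$. $\Gamma_{\mathbf a}$ is the graph on $[n]$ whose edges are $\{i,j\}$ with $i<j\le i+a_i$ (naturally directed $i\to j$). An orientation assigns a direction to each edge; an edge $\{i,j\}$ with $i<j$ is ascending if it is oriented $i\to j$. The edges $\{i,i+1\},\dots,\{i,i+a_i\}$ form row $i$. -}

module Defs where

open import Data.Nat using (ℕ; zero; suc; _+_; _≤_; _<_; _≤?_; _<?_)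
open import Data.Fin using (Fin; toℕ; fromℕ; fromℕ<)
open import Data.List using (List; length; filter)
open import Data.List using () renaming (allFin to listAllFin)
open import Data.Bool using (Bool; true; false)
open import Data.Product using (_×_; Σ; _,_)
open import Data.Sum using (_⊎_)
open import Relation.Nullary using (¬_; Dec)
open import Relation.Nullary.Decidable using (_×-dec_)
open import Relation.Binary.PropositionalEquality using (_≡_)
open import Data.Bool using (_≟_)
open import Relation.Binary.Construct.Closure.Transitive using (TransClosure)

-- Vertices of Γ_a are Fin n; the vertex k : Fin n stands for k+1 ∈ [n].

-- Area sequence of length n = suc m (indices cyclic mod n) with a_n = 0:
--   0 ≤ a_i ≤ n-1,  a_i - 1 ≤ a_{i+1} (i.e. a_i ≤ a_{i+1} + 1), a_n = 0.
record AreaSeq (m : ℕ) (a : Fin (suc m) → ℕ) : Set where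
  field
    bounded : ∀ i → a i ≤ m
    step    : ∀ i → (p : suc (toℕ i) < suc m) → a i ≤ suc (a (fromℕ< p))
    wrap    : a (fromℕ m) ≤ suc (a Fin.zero)
    last0   : a (fromℕ m) ≡ 0

Edge : ∀ {n} (a : Fin n → ℕ) → Fin n → Fin n → Set
Edge a i j = (toℕ i < toℕ j) × (toℕ j ≤ toℕ i + a i)

edge? : ∀ {n} (a : Fin n → ℕ) (i j : Fin n) → Dec (Edge a i j)
edge? a i j = (toℕ i <? toℕ j) ×-dec (toℕ j ≤? toℕ i + a i)

-- An orientation: for each edge {i,j} (i<j), o i j = true means the edge is
-- oriented i → j (ascending), false means j → i.  Values off edges are irrelevant.
Orientation : ℕ → Set
Orientation n = Fin n → Fin n → Bool

Arc : ∀ {n} (a : Fin n → ℕ) → Orientation n → Fin n → Fin n → Set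
Arc a o u v = (Edge a u v × o u v ≡ true) ⊎ (Edge a v u × o v u ≡ false)

Acyclic : ∀ {n} (a : Fin n → ℕ) → Orientation n → Set
Acyclic {n} a o = ∀ (u : Fin n) → ¬ TransClosure (Arc a o) u u

ascCount : ∀ {n} (a : Fin n → ℕ) → Orientation n → Fin n → ℕ
ascCount {n} a o i =
  length (filter (λ j → edge? a i j ×-dec (o i j ≟ true)) (listAllFin n))

SameOrientation : ∀ {n} (a : Fin n → ℕ) → Orientation n → Orientation n → Set
SameOrientation {n} a o o' = ∀ (i j : Fin n) → Edge a i j → o i j ≡ o' i j

-- A ranking r of the vertices orients every edge towards the higher rank, and such an
-- orientation is acyclic. Ranks are assigned from the last vertex to the first: vertex i is
-- inserted among the already ranked vertices i+1, …, n, and as its rank rises the number of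
-- its out-neighbours ranked above it falls from a_i to 0 by at most one per step; so it can be made v_i.
-- Uniqueness goes row by row from the bottom. If two acyclic orientations agree on all rows
-- below i and have the same number of ascents in row i but differ there, then two edges {i,j},
-- {i,k} of row i are oriented oppositely in each of them. Since i + a_i is monotone in i, the
-- forward neighbourhood of i is a clique, so {j,k} is an edge, and whichever way it points,
-- one of the two orientations contains the directed triangle on i, j, k.
module Submission where

open import Defs
import Data.Nat as ℕ
open import Data.Nat using (ℕ; zero; suc; _+_; _∸_; _≤_; _<_; _≤?_; _<?_; z≤n; s≤s; z<s; s<s)
open import Data.Nat.Properties
  using (≤-refl; ≤-reflexive; ≤-trans; ≤-antisym; ≤-pred; ≰⇒>; ≮⇒≥; <⇒≱; n≮0; m≤n⇒m<n∨m≡n; <ᵇ⇒<; +-comm; <⇒≤; n≤1+n;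
         +-suc; +-identityʳ; +-mono-≤; +-monoʳ-≤; +-monoˡ-≤; m≤n+m; m∸n+n≡m; module ≤-Reasoning)
open import Data.Fin using (Fin; zero; suc; toℕ; fromℕ; fromℕ<; punchIn)
import Data.Fin as F using (_<_)
open import Data.Fin.Properties
  using (toℕ-injective; toℕ-fromℕ; toℕ-fromℕ<; toℕ<n; toℕ≤pred[n]; <-irrefl; <-trans; <-cmp; <⇒≢; ≤∧≢⇒<;
         punchIn-injective; punchInᵢ≢i; punchIn-mono-≤; punchIn-cancel-≤)
import Data.Fin.Properties as F using (_<?_)
open import Data.Fin.Induction using (>-wellFounded)
open import Data.List using (List; []; _∷_; length; filter; map; allFin)
open import Data.List.Properties using (filter-≐; filter-none; filter-accept; filter-reject; map-tabulate)
import Data.List.Relation.Unary.All as All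
open import Data.List.Relation.Unary.Any using (Any; here; there; satisfied)
import Data.List.Relation.Unary.Any as Any
open import Data.List.Relation.Unary.AllPairs using ([]; _∷_)
open import Data.List.Relation.Unary.Unique.Propositional using (Unique)
open import Data.List.Relation.Unary.Unique.Propositional.Properties using (allFin⁺)
open import Data.List.Membership.Propositional.Properties using (∈-allFin)
open import Data.Bool using (true; false; T)
open import Data.Unit using (tt)
open import Data.Empty using (⊥; ⊥-elim)
open import Data.Bool.Properties using (_≟_; ¬-not; not-¬)
open import Data.Product using (Σ; ∃-syntax; _×_; _,_; proj₁; proj₂)
open import Data.Sum using (_⊎_; inj₁; inj₂)
open import Function using (_∘_)
open import Function.Definitions using (Injective)
import Induction.WellFounded as WF
open import Level using (0ℓ)
open import Relation.Nullary using (¬_; yes; no; does; contradiction)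
open import Relation.Nullary.Decidable using (_×-dec_; dec-true)
open import Relation.Unary using (Pred; Decidable; _⊆_; _≐_; _∪_; _∩_; ∁)
open import Relation.Binary using (tri<; tri≈; tri>)
open import Relation.Binary.PropositionalEquality using (_≡_; _≢_; refl; sym; trans; cong; cong₂; subst; module ≡-Reasoning)
open import Relation.Binary.Construct.Closure.Transitive using (TransClosure; [_]; _∷_)

count : ∀ {a p} {A : Set a} {P : Pred A p} → Decidable P → List A → ℕ
count P? xs = length (filter P? xs)

module _ {a p} {A : Set a} {P : Pred A p} (P? : Decidable P) where

  count-none : ∀ {xs} → All.All (∁ P) xs → count P? xs ≡ 0
  count-none ¬Pxs = cong length (filter-none P? ¬Pxs)

  count-accept : ∀ {x} xs → P x → count P? (x ∷ xs) ≡ suc (count P? xs)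
  count-accept xs Px = cong length (filter-accept P? Px)

  count-reject : ∀ {x} xs → ¬ P x → count P? (x ∷ xs) ≡ count P? xs
  count-reject xs ¬Px = cong length (filter-reject P? ¬Px)

  count-unique≤1 : ∀ {xs} → Unique xs → (∀ {x y} → P x → P y → x ≡ y) → count P? xs ≤ 1
  count-unique≤1 [] _ = z≤n
  count-unique≤1 {x ∷ xs} (x∉xs ∷ xs!) P-unique with P? x
  ... | no _ = count-unique≤1 xs! P-unique
  ... | yes Px = s≤s (≤-reflexive (count-none (All.map (λ x≢y Py → x≢y (P-unique Px Py)) x∉xs)))

  count-map : ∀ {b} {B : Set b} (f : B → A) xs → count P? (map f xs) ≡ count (P? ∘ f) xs
  count-map f [] = refl
  count-map f (x ∷ xs) with P? (f x)
  ... | yes _ = cong suc (count-map f xs)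
  ... | no _ = count-map f xs

  count-≤-∷ : ∀ x xs → count P? xs ≤ count P? (x ∷ xs)
  count-≤-∷ x xs with P? x
  ... | yes _ = n≤1+n _
  ... | no _ = ≤-refl

allFin-suc : ∀ n → allFin (suc n) ≡ zero ∷ map suc (allFin n)
allFin-suc n = cong (zero ∷_) (sym (map-tabulate (λ i → i) suc))

count-allFin-suc : ∀ {p n} {P : Pred (Fin (suc n)) p} (P? : Decidable P) → ¬ P zero →
  count P? (allFin (suc n)) ≡ count (P? ∘ suc) (allFin n)
count-allFin-suc {n = n} P? ¬P0 = begin
  count P? (allFin (suc n))          ≡⟨ cong (count P?) (allFin-suc n) ⟩
  count P? (zero ∷ map suc (allFin n)) ≡⟨ count-reject P? (map suc (allFin n)) ¬P0 ⟩
  count P? (map suc (allFin n))      ≡⟨ count-map P? suc (allFin n) ⟩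
  count (P? ∘ suc) (allFin n)        ∎
  where open ≡-Reasoning

module _ {a p q} {A : Set a} {P : Pred A p} {Q : Pred A q} (P? : Decidable P) (Q? : Decidable Q) where

  count-≐ : P ≐ Q → ∀ xs → count P? xs ≡ count Q? xs
  count-≐ P≐Q xs = cong length (filter-≐ P? Q? P≐Q xs)

  count<⇒Any : ∀ xs → count P? xs < count Q? xs → Any (Q ∩ ∁ P) xs
  count<⇒Any (x ∷ xs) lt with P? x | Q? x
  ... | yes _  | yes _  = there (count<⇒Any xs (≤-pred lt))
  ... | no ¬Px | yes Qx = here (Qx , ¬Px)
  ... | yes _  | no _   = there (count<⇒Any xs (≤-trans (n≤1+n _) lt))
  ... | no _   | no _   = there (count<⇒Any xs lt)

  count≤⇒Any : ∀ xs → count P? xs ≤ count Q? xs → Any (P ∩ ∁ Q) xs → Any (Q ∩ ∁ P) xs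
  count≤⇒Any (x ∷ xs) le any with P? x | Q? x | any
  ... | yes _  | yes _  | there any′ = there (count≤⇒Any xs (≤-pred le) any′)
  ... | yes _  | yes Qx | here (_ , ¬Qx) = contradiction Qx ¬Qx
  ... | no ¬Px | yes Qx | _ = here (Qx , ¬Px)
  ... | yes _  | no _   | _ = there (count<⇒Any xs le)
  ... | no _   | no _   | there any′ = there (count≤⇒Any xs le any′)
  ... | no ¬Px | no _   | here (Px , _) = contradiction Px ¬Px

module _ {a p q r} {A : Set a} {P : Pred A p} {Q : Pred A q} {R : Pred A r}
         (P? : Decidable P) (Q? : Decidable Q) (R? : Decidable R) where

  count-⊆-∪ : P ⊆ Q ∪ R → ∀ xs → count P? xs ≤ count Q? xs + count R? xs
  count-⊆-∪ P⊆Q∪R [] = z≤n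
  count-⊆-∪ P⊆Q∪R (x ∷ xs) with P? x
  ... | no _ = ≤-trans (count-⊆-∪ P⊆Q∪R xs) (+-mono-≤ (count-≤-∷ Q? x xs) (count-≤-∷ R? x xs))
  ... | yes Px with P⊆Q∪R Px
  ...   | inj₁ Qx = begin
    suc (count P? xs)                         ≤⟨ s≤s (count-⊆-∪ P⊆Q∪R xs) ⟩
    suc (count Q? xs + count R? xs)           ≤⟨ s≤s (+-monoʳ-≤ (count Q? xs) (count-≤-∷ R? x xs)) ⟩
    suc (count Q? xs) + count R? (x ∷ xs)     ≡⟨ cong (_+ count R? (x ∷ xs)) (sym (count-accept Q? xs Qx)) ⟩
    count Q? (x ∷ xs) + count R? (x ∷ xs)     ∎
    where open ≤-Reasoning
  ...   | inj₂ Rx = begin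
    suc (count P? xs)                         ≤⟨ s≤s (count-⊆-∪ P⊆Q∪R xs) ⟩
    suc (count Q? xs + count R? xs)           ≤⟨ s≤s (+-monoˡ-≤ (count R? xs) (count-≤-∷ Q? x xs)) ⟩
    suc (count Q? (x ∷ xs) + count R? xs)     ≡⟨ sym (+-suc _ _) ⟩
    count Q? (x ∷ xs) + suc (count R? xs)     ≡⟨ cong (count Q? (x ∷ xs) +_) (sym (count-accept R? xs Rx)) ⟩
    count Q? (x ∷ xs) + count R? (x ∷ xs)     ∎
    where open ≤-Reasoning

count-range : ∀ {N} s c → s + c ≤ N →
  count (λ (j : Fin N) → (s ≤? toℕ j) ×-dec (toℕ j <? s + c)) (allFin N) ≡ c
count-range {N} zero zero _ = count-none _ (All.universal (λ _ ()) (allFin N))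
count-range {suc N} zero (suc c) (s≤s c≤N) = begin
  count R? (allFin (suc N))            ≡⟨ cong (count R?) (allFin-suc N) ⟩
  count R? (zero ∷ map suc (allFin N)) ≡⟨ count-accept R? (map suc (allFin N)) (z≤n , z<s) ⟩
  suc (count R? (map suc (allFin N)))  ≡⟨ cong suc (count-map R? suc (allFin N)) ⟩
  suc (count (R? ∘ suc) (allFin N))    ≡⟨ cong suc (count-≐ (R? ∘ suc) R′? ((λ (_ , lt) → z≤n , ≤-pred lt) , (λ (_ , lt) → z≤n , s<s lt)) (allFin N)) ⟩
  suc (count R′? (allFin N))           ≡⟨ cong suc (count-range zero c c≤N) ⟩
  suc c                                ∎
  where
    open ≡-Reasoning
    R? = λ (j : Fin (suc N)) → (0 ≤? toℕ j) ×-dec (toℕ j <? suc c)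
    R′? = λ (j : Fin N) → (0 ≤? toℕ j) ×-dec (toℕ j <? c)
count-range {suc N} (suc s) c (s≤s s+c≤N) = begin
  count R? (allFin (suc N))            ≡⟨ count-allFin-suc R? (λ ()) ⟩
  count (R? ∘ suc) (allFin N)          ≡⟨ count-≐ (R? ∘ suc) R′? ((λ (le , lt) → ≤-pred le , ≤-pred lt) , (λ (le , lt) → s≤s le , s<s lt)) (allFin N) ⟩
  count R′? (allFin N)                 ≡⟨ count-range s c s+c≤N ⟩
  c                                    ∎
  where
    open ≡-Reasoning
    R? = λ (j : Fin (suc N)) → (suc s ≤? toℕ j) ×-dec (toℕ j <? suc s + c)
    R′? = λ (j : Fin N) → (s ≤? toℕ j) ×-dec (toℕ j <? s + c)

discrete-ivt : (g : ℕ → ℕ) → (∀ t → g t ≤ suc (g (suc t))) →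
  ∀ {w} B → g B ≤ w → w ≤ g 0 → ∃[ t ] t ≤ B × g t ≡ w
discrete-ivt g _ zero gB≤w w≤g0 = 0 , z≤n , ≤-antisym gB≤w w≤g0
discrete-ivt g step {w} (suc B) gB≤w w≤g0 with g 0 ≤? w
... | yes g0≤w = 0 , z≤n , ≤-antisym g0≤w w≤g0
... | no g0≰w with discrete-ivt (g ∘ suc) (step ∘ suc) B gB≤w (≤-pred (≤-trans (≰⇒> g0≰w) (step 0)))
...   | t , t≤B , g[1+t]≡w = suc t , s≤s t≤B , g[1+t]≡w

punchIn-mono-< : ∀ {n} i (j k : Fin n) → j F.< k → punchIn i j F.< punchIn i k
punchIn-mono-< i j k j<k = ≰⇒> (λ pk≤pj → <⇒≱ j<k (punchIn-cancel-≤ i k j pk≤pj))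

punchIn-cancel-< : ∀ {n} i (j k : Fin n) → punchIn i j F.< punchIn i k → j F.< k
punchIn-cancel-< i j k pj<pk = ≰⇒> (λ k≤j → <⇒≱ pj<pk (punchIn-mono-≤ i k j k≤j))

<punchIn⇒≤ : ∀ {n} i (j : Fin n) → i F.< punchIn i j → toℕ i ≤ toℕ j
<punchIn⇒≤ zero j _ = z≤n
<punchIn⇒≤ (suc i) (suc j) (s<s i<pj) = s≤s (<punchIn⇒≤ i j i<pj)

≤⇒<punchIn : ∀ {n} i (j : Fin n) → toℕ i ≤ toℕ j → i F.< punchIn i j
≤⇒<punchIn zero j _ = z<s
≤⇒<punchIn (suc i) (suc j) (s≤s i≤j) = s<s (≤⇒<punchIn i j i≤j)

Forward : ∀ {n ℓ} → (Fin n → Fin n → Set ℓ) → Set ℓ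
Forward E = ∀ {i j} → E i j → i F.< j

rankAscents : ∀ {n ℓ} {E : Fin n → Fin n → Set ℓ} → (∀ i → Decidable (E i)) → (Fin n → Fin n) → Fin n → ℕ
rankAscents {n} E? r i = count (λ j → E? i j ×-dec (r i F.<? r j)) (allFin n)

module Insertion {n ℓ} {E : Fin (suc n) → Fin (suc n) → Set ℓ} (E? : ∀ i → Decidable (E i))
                 (forward : Forward E) (r : Fin n → Fin n) (r-injective : Injective _≡_ _≡_ r) where

  E⁺? : ∀ x → Decidable (λ y → E (suc x) (suc y))
  E⁺? x = E? (suc x) ∘ suc

  above : ℕ → ℕ
  above t = count (λ x → E? zero (suc x) ×-dec (t ≤? toℕ (r x))) (allFin n)

  above-zero : above 0 ≡ count (E? zero) (allFin (suc n))
  above-zero = sym (trans (count-allFin-suc (E? zero) (n≮0 ∘ forward))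
                          (count-≐ _ _ ((λ e → e , z≤n) , proj₁) (allFin n)))

  above-n : above n ≡ 0
  above-n = count-none _ (All.universal (λ x (_ , n≤rx) → <⇒≱ (toℕ<n (r x)) n≤rx) (allFin n))

  above-step : ∀ t → above t ≤ suc (above (suc t))
  above-step t = begin
    above t                                    ≤⟨ count-⊆-∪ _ _ rank≡t? split (allFin n) ⟩
    above (suc t) + count rank≡t? (allFin n)   ≤⟨ +-monoʳ-≤ (above (suc t)) (count-unique≤1 rank≡t? (allFin⁺ n) same-rank) ⟩
    above (suc t) + 1                          ≡⟨ +-comm (above (suc t)) 1 ⟩
    suc (above (suc t))                        ∎
    where
      open ≤-Reasoning
      rank≡t? : Decidable (λ x → toℕ (r x) ≡ t)
      rank≡t? x = toℕ (r x) ℕ.≟ t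
      same-rank : ∀ {x y} → toℕ (r x) ≡ t → toℕ (r y) ≡ t → x ≡ y
      same-rank rx≡t ry≡t = r-injective (toℕ-injective (trans rx≡t (sym ry≡t)))
      split : ∀ {x} → E zero (suc x) × t ≤ toℕ (r x) → (E zero (suc x) × suc t ≤ toℕ (r x)) ⊎ toℕ (r x) ≡ t
      split (e , t≤rx) with m≤n⇒m<n∨m≡n t≤rx
      ... | inj₁ t<rx = inj₁ (e , t<rx)
      ... | inj₂ t≡rx = inj₂ (sym t≡rx)

  insert : Fin (suc n) → Fin (suc n) → Fin (suc n)
  insert τ zero = τ
  insert τ (suc x) = punchIn τ (r x)

  insert-injective : ∀ τ → Injective _≡_ _≡_ (insert τ)
  insert-injective τ {zero} {zero} _ = refl
  insert-injective τ {zero} {suc y} τ≡τ↑ry = contradiction (sym τ≡τ↑ry) (punchInᵢ≢i τ (r y))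
  insert-injective τ {suc x} {zero} τ↑rx≡τ = contradiction τ↑rx≡τ (punchInᵢ≢i τ (r x))
  insert-injective τ {suc x} {suc y} eq = cong suc (r-injective (punchIn-injective τ (r x) (r y) eq))

  insert-ascents-zero : ∀ τ → rankAscents E? (insert τ) zero ≡ above (toℕ τ)
  insert-ascents-zero τ = trans (count-allFin-suc (λ j → E? zero j ×-dec (τ F.<? insert τ j)) (n≮0 ∘ forward ∘ proj₁))
    (count-≐ (λ x → E? zero (suc x) ×-dec (τ F.<? punchIn τ (r x))) (λ x → E? zero (suc x) ×-dec (toℕ τ ≤? toℕ (r x)))
      ((λ (e , lt) → e , <punchIn⇒≤ τ _ lt) , (λ (e , le) → e , ≤⇒<punchIn τ _ le)) (allFin n))

  insert-ascents-suc : ∀ τ i → rankAscents E? (insert τ) (suc i) ≡ rankAscents E⁺? r i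
  insert-ascents-suc τ i = trans (count-allFin-suc (λ j → E? (suc i) j ×-dec (insert τ (suc i) F.<? insert τ j)) (n≮0 ∘ forward ∘ proj₁))
    (count-≐ (λ x → E⁺? i x ×-dec (punchIn τ (r i) F.<? punchIn τ (r x))) (λ x → E⁺? i x ×-dec (r i F.<? r x))
      ((λ (e , lt) → e , punchIn-cancel-< τ _ _ lt) , (λ (e , lt) → e , punchIn-mono-< τ _ _ lt)) (allFin n))

  extend-ranking : (v : Fin (suc n) → ℕ) → v zero ≤ count (E? zero) (allFin (suc n)) →
    (∀ i → rankAscents E⁺? r i ≡ v (suc i)) →
    Σ (Fin (suc n) → Fin (suc n)) λ r′ → Injective _≡_ _≡_ r′ × (∀ i → rankAscents E? r′ i ≡ v i)
  extend-ranking v v₀≤deg r-ascents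
    with discrete-ivt above above-step n (≤-trans (≤-reflexive above-n) z≤n) (subst (v zero ≤_) (sym above-zero) v₀≤deg)
  ... | t , t≤n , above-t≡v₀ = insert τ , insert-injective τ , ascents
    where
      τ : Fin (suc n)
      τ = fromℕ< (s≤s t≤n)
      ascents : ∀ i → rankAscents E? (insert τ) i ≡ v i
      ascents zero = trans (insert-ascents-zero τ) (trans (cong above (toℕ-fromℕ< (s≤s t≤n))) above-t≡v₀)
      ascents (suc i) = trans (insert-ascents-suc τ i) (r-ascents i)

ranking-with-ascents : ∀ {n ℓ} {E : Fin n → Fin n → Set ℓ} (E? : ∀ i → Decidable (E i)) → Forward E →
  (v : Fin n → ℕ) → (∀ i → v i ≤ count (E? i) (allFin n)) →
  Σ (Fin n → Fin n) λ r → Injective _≡_ _≡_ r × (∀ i → rankAscents E? r i ≡ v i)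
ranking-with-ascents {zero} _ _ _ _ = (λ ()) , (λ { {()} }) , (λ ())
ranking-with-ascents {suc n} E? forward v v≤deg
  with ranking-with-ascents (λ x → E? (suc x) ∘ suc) (≤-pred ∘ forward) (v ∘ suc)
         (λ i → ≤-trans (v≤deg (suc i)) (≤-reflexive (count-allFin-suc (E? (suc i)) (n≮0 ∘ forward))))
... | r , r-injective , r-ascents = Insertion.extend-ranking E? forward r r-injective v (v≤deg zero) r-ascents

rankOrientation : ∀ {n} → (Fin n → Fin n) → Orientation n
rankOrientation r i j = does (r i F.<? r j)

-- `does` of Fin's `_<?_` computes to `_<ᵇ_` on the underlying naturals.
rankOrientation-true : ∀ {n} (r : Fin n → Fin n) {i j} → rankOrientation r i j ≡ true → r i F.< r j
rankOrientation-true r {i} {j} ascending = <ᵇ⇒< (toℕ (r i)) (toℕ (r j)) (subst T (sym ascending) tt)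

module _ {n} (a : Fin n → ℕ) {r : Fin n → Fin n} (r-injective : Injective _≡_ _≡_ r) where

  arc-rank< : ∀ {u w} → Arc a (rankOrientation r) u w → r u F.< r w
  arc-rank< (inj₁ (_ , ascending)) = rankOrientation-true r ascending
  arc-rank< {u} {w} (inj₂ ((w<u , _) , descending)) =
    ≤∧≢⇒< (≮⇒≥ (λ rw<ru → contradiction (trans (sym descending) (dec-true (r w F.<? r u) rw<ru)) λ ()))
          (λ ru≡rw → <⇒≢ w<u (sym (r-injective ru≡rw)))

  rankOrientation-acyclic : Acyclic a (rankOrientation r)
  rankOrientation-acyclic u cycle = <-irrefl refl (path-rank< cycle)
    where
      path-rank< : ∀ {u w} → TransClosure (Arc a (rankOrientation r)) u w → r u F.< r w
      path-rank< [ uw ] = arc-rank< uw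
      path-rank< (uv ∷ vw) = <-trans (arc-rank< uv) (path-rank< vw)

  ascCount-rankOrientation : ∀ i → ascCount a (rankOrientation r) i ≡ rankAscents (edge? a) r i
  ascCount-rankOrientation i = count-≐ (λ j → edge? a i j ×-dec (rankOrientation r i j ≟ true)) (λ j → edge? a i j ×-dec (r i F.<? r j))
    ((λ (e , asc) → e , rankOrientation-true r asc) , (λ (e , lt) → e , dec-true (r i F.<? r _) lt)) (allFin n)

stepwise-mono : ∀ {n} (f : Fin n → ℕ) → (∀ i (p : suc (toℕ i) < n) → f i ≤ f (fromℕ< p)) →
  ∀ {i j} → toℕ i ≤ toℕ j → f i ≤ f j
stepwise-mono {n} f step {i} {j} i≤j = go (toℕ j ∸ toℕ i) i (m∸n+n≡m i≤j)
  where
    go : ∀ k i → k + toℕ i ≡ toℕ j → f i ≤ f j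
    go zero i i≡j = ≤-reflexive (cong f (toℕ-injective i≡j))
    go (suc k) i k+i≡j = ≤-trans (step i i+1<n) (go k (fromℕ< i+1<n) k+i+1≡j)
      where
        i+1<n : suc (toℕ i) < n
        i+1<n = ≤-trans (s≤s (s≤s (m≤n+m (toℕ i) k))) (≤-trans (s≤s (≤-reflexive k+i≡j)) (toℕ<n j))
        k+i+1≡j : k + toℕ (fromℕ< i+1<n) ≡ toℕ j
        k+i+1≡j = trans (cong (k +_) (toℕ-fromℕ< i+1<n)) (trans (+-suc k (toℕ i)) k+i≡j)

RowsAreCliques : ∀ {n} → (Fin n → ℕ) → Set
RowsAreCliques a = ∀ {i j k} → Edge a i j → Edge a i k → toℕ j < toℕ k → Edge a j k

module AreaSequence {m} {a : Fin (suc m) → ℕ} (A : AreaSeq m a) where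
  open AreaSeq A

  reach : Fin (suc m) → ℕ
  reach i = toℕ i + a i

  reach-mono : ∀ {i j} → toℕ i ≤ toℕ j → reach i ≤ reach j
  reach-mono = stepwise-mono reach reach-step
    where
      reach-step : ∀ i (p : suc (toℕ i) < suc m) → reach i ≤ reach (fromℕ< p)
      reach-step i p = begin
        toℕ i + a i                        ≤⟨ +-monoʳ-≤ (toℕ i) (step i p) ⟩
        toℕ i + suc (a (fromℕ< p))         ≡⟨ +-suc (toℕ i) _ ⟩
        suc (toℕ i) + a (fromℕ< p)         ≡⟨ cong (_+ a (fromℕ< p)) (sym (toℕ-fromℕ< p)) ⟩
        toℕ (fromℕ< p) + a (fromℕ< p)      ∎
        where open ≤-Reasoning

  reach≤m : ∀ i → reach i ≤ m
  reach≤m i = begin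
    reach i                       ≤⟨ reach-mono (subst (toℕ i ≤_) (sym (toℕ-fromℕ m)) (toℕ≤pred[n] i)) ⟩
    toℕ (fromℕ m) + a (fromℕ m)   ≡⟨ cong₂ _+_ (toℕ-fromℕ m) last0 ⟩
    m + 0                         ≡⟨ +-identityʳ m ⟩
    m                             ∎
    where open ≤-Reasoning

  rows-are-cliques : RowsAreCliques a
  rows-are-cliques (i<j , _) (_ , k≤i+aᵢ) j<k = j<k , ≤-trans k≤i+aᵢ (reach-mono (<⇒≤ i<j))

  count-row : ∀ i → count (edge? a i) (allFin (suc m)) ≡ a i
  count-row i = trans
    (count-≐ (edge? a i) (λ j → (suc (toℕ i) ≤? toℕ j) ×-dec (toℕ j <? suc (toℕ i) + a i))
      ((λ (i<j , j≤) → i<j , s≤s j≤) , (λ (i<j , j<) → i<j , ≤-pred j<)) (allFin (suc m)))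
    (count-range (suc (toℕ i)) (a i) (s≤s (reach≤m i)))

AgreeOnRow : ∀ {n} → (Fin n → ℕ) → Orientation n → Orientation n → Fin n → Set
AgreeOnRow a o o′ i = ∀ j → Edge a i j → o i j ≡ o′ i j

module Uniqueness {n} {a : Fin n → ℕ} (cliques : RowsAreCliques a) where

  arc-either : ∀ o {u w} → Edge a u w ⊎ Edge a w u → Arc a o u w ⊎ Arc a o w u
  arc-either o {u} {w} (inj₁ e) with o u w
  ... | true  = inj₁ (inj₁ (e , refl))
  ... | false = inj₂ (inj₂ (e , refl))
  arc-either o {u} {w} (inj₂ e) with o w u
  ... | true  = inj₂ (inj₁ (e , refl))
  ... | false = inj₁ (inj₂ (e , refl))

  arc-transport : ∀ {o o′ u w} → AgreeOnRow a o o′ u → AgreeOnRow a o o′ w → Arc a o u w → Arc a o′ u w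
  arc-transport agree-u _ (inj₁ (e , ouw)) = inj₁ (e , trans (sym (agree-u _ e)) ouw)
  arc-transport _ agree-w (inj₂ (e , owu)) = inj₂ (e , trans (sym (agree-w _ e)) owu)

  row-adjacent : ∀ {i j k} → Edge a i j → Edge a i k → j ≢ k → Edge a j k ⊎ Edge a k j
  row-adjacent eij eik j≢k with <-cmp _ _
  ... | tri< j<k _ _ = inj₁ (cliques eij eik j<k)
  ... | tri≈ _ j≡k _ = contradiction j≡k j≢k
  ... | tri> _ _ k<j = inj₂ (cliques eik eij k<j)

  no-swapped-pair : ∀ {o o′ i j k} → Acyclic a o → Acyclic a o′ → (∀ {x} → i F.< x → AgreeOnRow a o o′ x) →
    Edge a i j → Edge a i k → j ≢ k → o i j ≡ true → o i k ≡ false → o′ i j ≡ false → o′ i k ≡ true → ⊥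
  no-swapped-pair {o} {i = i} o-acyclic o′-acyclic agree-below eij eik j≢k oij oik o′ij o′ik
    with arc-either o (row-adjacent eij eik j≢k)
  ... | inj₁ jk = o-acyclic i (inj₁ (eij , oij) ∷ jk ∷ [ inj₂ (eik , oik) ])
  ... | inj₂ kj = o′-acyclic i (inj₁ (eik , o′ik) ∷ arc-transport (agree-below (proj₁ eik)) (agree-below (proj₁ eij)) kj
                                ∷ [ inj₂ (eij , o′ij) ])

  no-lost-ascent : ∀ {o o′ i j} → Acyclic a o → Acyclic a o′ → ascCount a o i ≤ ascCount a o′ i →
    (∀ {k} → i F.< k → AgreeOnRow a o o′ k) → Edge a i j → o i j ≡ true → o′ i j ≡ false → ⊥
  no-lost-ascent {o} {o′} {i} {j} o-acyclic o′-acyclic asc≤asc′ agree-below eij oij o′ij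
    with satisfied (count≤⇒Any (λ k → edge? a i k ×-dec (o i k ≟ true)) (λ k → edge? a i k ×-dec (o′ i k ≟ true))
           (allFin n) asc≤asc′ (Any.map (λ { refl → (eij , oij) , λ (_ , o′ij≡true) → not-¬ o′ij o′ij≡true }) (∈-allFin j)))
  ... | k , (eik , o′ik) , ¬ascending =
    no-swapped-pair o-acyclic o′-acyclic agree-below eij eik (λ { refl → not-¬ oik oij }) oij oik o′ij o′ik
    where
      oik : o i k ≡ false
      oik = ¬-not (λ oik≡true → ¬ascending (eik , oik≡true))

  agree-on-row : ∀ {o o′ i} → Acyclic a o → Acyclic a o′ → ascCount a o i ≡ ascCount a o′ i →
    (∀ {k} → i F.< k → AgreeOnRow a o o′ k) → AgreeOnRow a o o′ i
  agree-on-row {o} {o′} {i} o-acyclic o′-acyclic asc≡asc′ agree-below j eij with o i j in oij | o′ i j in o′ij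
  ... | true  | true  = refl
  ... | false | false = refl
  ... | true  | false = ⊥-elim (no-lost-ascent o-acyclic o′-acyclic (≤-reflexive asc≡asc′) agree-below eij oij o′ij)
  ... | false | true  = ⊥-elim (no-lost-ascent o′-acyclic o-acyclic (≤-reflexive (sym asc≡asc′))
                                  (λ i<k x e → sym (agree-below i<k x e)) eij o′ij oij)

  unique-orientation : ∀ {o o′} → Acyclic a o → Acyclic a o′ → (∀ i → ascCount a o i ≡ ascCount a o′ i) →
    SameOrientation a o o′
  unique-orientation {o} {o′} o-acyclic o′-acyclic asc≡asc′ =
    WF.All.wfRec >-wellFounded 0ℓ (AgreeOnRow a o o′) (λ i → agree-on-row o-acyclic o′-acyclic (asc≡asc′ i))

mainTheorem19 : (m : ℕ) (a : Fin (suc m) → ℕ) → AreaSeq m a →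
    (v : Fin (suc m) → ℕ) → (∀ i → v i ≤ a i) →
    Σ (Orientation (suc m)) λ o →
      (Acyclic a o × (∀ i → ascCount a o i ≡ v i)) ×
      (∀ (o' : Orientation (suc m)) → Acyclic a o' →
        (∀ i → ascCount a o' i ≡ v i) → SameOrientation a o o')
mainTheorem19 m a A v v≤a = rankOrientation r , (acyclic , ascents) , unique
  where
    open AreaSequence A
    ranking : Σ (Fin (suc m) → Fin (suc m)) λ r → Injective _≡_ _≡_ r × (∀ i → rankAscents (edge? a) r i ≡ v i)
    ranking = ranking-with-ascents (edge? a) proj₁ v (λ i → subst (v i ≤_) (sym (count-row i)) (v≤a i))
    r : Fin (suc m) → Fin (suc m)
    r = proj₁ ranking
    r-injective : Injective _≡_ _≡_ r
    r-injective = proj₁ (proj₂ ranking)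
    -- r is passed explicitly below: inferring it from r-injective makes Agda unfold ranking-with-ascents.
    acyclic : Acyclic a (rankOrientation r)
    acyclic = rankOrientation-acyclic a {r} r-injective
    ascents : ∀ i → ascCount a (rankOrientation r) i ≡ v i
    ascents i = trans (ascCount-rankOrientation a {r} r-injective i) (proj₂ (proj₂ ranking) i)
    unique : ∀ o′ → Acyclic a o′ → (∀ i → ascCount a o′ i ≡ v i) → SameOrientation a (rankOrientation r) o′
    unique o′ o′-acyclic o′-ascents =
      Uniqueness.unique-orientation rows-are-cliques acyclic o′-acyclic (λ i → trans (ascents i) (sym (o′-ascents i)))
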